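{- The class $G_{\mathcal{W}}=\{G : G\cong G_\pi \text{ for some } \pi\in\mathcal{W}\}$ is not $2$-well-quasi-ordered: there is an infinite set of graphs in $G_{\mathcal{W}}$, each with every vertex labelled by one of two incomparable labels, which forms an antichain in the labelled induced subgraph order.
   Context: Permutations are identified with their plots $\{(i,\pi(i))\}$, and more generally with finite generic point sets (no two points share an $x$- or $y$-coordinate), up to order-isomorphism; $\sigma$ is contained in $\pi$ if some subset of the plot of $\pi$ is order-isomorphic to that of $\sigma$. The permutation graph $G_\pi$ of $\pi=\pi(1)\cdots\pi(n)$ has vertices $1,\dots,n$, with $i<j$ adjacent iff $\pi(i)>\pi(j)$. Widdershins spirals: the rectangular hull of a finite point set is the smallest axis-parallel rectangle containing it. Given $p_1,\dots,p_i$, a proper pin for $(p_1,\dots,p_i)$ is a point $p$ outside the rectangular hull $R$ of $\{p_1,\dots,p_i\}$ lying horizontally or vertically between $p_i$ and the rectangular hull of $\{p_1,\dots,p_{i-1}\}$; it is a left/right/up/down pin according as it lies left of/right of/above/below $R$. A widdershins spiral of standard orientation is (the permutation of) a generic point sequence $p_1,\dots,p_k$, $k\ge4$, with $p_2$ above and to the left of $p_1$, each $p_{i+1}$ ($i\ge2$) a proper pin for $(p_1,\dots,p_i)$, and directions of $p_3,p_4,\dots$ an initial segment of left, down, right, up, left, down, right, up, $\dots$. A widdershins spiral is such a permutation or its rotation by $90^\circ,180^\circ,270^\circ$. $\mathcal{W}$ is the set of permutations contained in some widdershins spiral. Labelled graphs: for a quasi-order $(X,\le)$, a labelling of $G$ is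 a map $\ell:V(G)\to X$. $(H,k)$ is a labelled induced subgraph of $(G,\ell)$ if there is an isomorphism from $H$ onto an induced subgraph of $G$ mapping each vertex $v$ to a vertex $w$ with $k(v)\le \ell(w)$. A class of graphs is $2$-well-quasi-ordered if, taking $X$ to be a $2$-element antichain, the set of all graphs in the class labelled by $X$ contains no infinite antichain in the labelled induced subgraph order. -}

module Defs where

open import Data.Nat as ℕ using (ℕ; zero; suc; _<ᵇ_)
open import Data.Integer as ℤ using (ℤ; -_)
open import Data.Fin as Fin using (Fin; toℕ)
open import Data.Fin.Permutation using (Permutation′; _⟨$⟩ʳ_)
open import Data.Bool using (Bool; _∧_; _∨_)
open import Data.Product using (Σ; ∃; _×_; _,_; proj₁; proj₂)
open import Data.Sum using (_⊎_)
open import Relation.Binary.PropositionalEquality using (_≡_; _≢_)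
open import Relation.Nullary using (¬_)
open import Function.Bundles using (_⇔_)
open import Function.Definitions using (Injective)

_≼_ : ∀ {k n} → Permutation′ k → Permutation′ n → Set
_≼_ {k} {n} σ π =
  Σ (Fin k → Fin n) λ f →
    (∀ a b → a Fin.< b → f a Fin.< f b) ×
    (∀ a b → ((σ ⟨$⟩ʳ a) Fin.< (σ ⟨$⟩ʳ b)) ⇔ ((π ⟨$⟩ʳ f a) Fin.< (π ⟨$⟩ʳ f b)))

Point : Set
Point = ℤ × ℤ

px py : Point → ℤ
px = proj₁
py = proj₂

-- A point sequence is q : ℕ → Point, of which the first k entries
-- q 0 , … , q (k-1) are used (0-indexed: q i is the paper's p_{i+1}).

Generic : ℕ → (ℕ → Point) → Set
Generic k q = ∀ i j → i ℕ.< k → j ℕ.< k → i ≢ j →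
  (px (q i) ≢ px (q j)) × (py (q i) ≢ py (q j))

LeftOf RightOf Above Below : (ℕ → Point) → ℕ → Point → Set
LeftOf  q m p = ∀ j → j ℕ.< m → px p ℤ.< px (q j)
RightOf q m p = ∀ j → j ℕ.< m → px (q j) ℤ.< px p
Above   q m p = ∀ j → j ℕ.< m → py (q j) ℤ.< py p
Below   q m p = ∀ j → j ℕ.< m → py p ℤ.< py (q j)

OutsideHull : (ℕ → Point) → ℕ → Point → Set
OutsideHull q m p = LeftOf q m p ⊎ RightOf q m p ⊎ Above q m p ⊎ Below q m p

-- Proper pin for the points q 0 , … , q l (l ≥ 1, so the earlier points
-- q 0 , … , q (l-1) form a nonempty set): p lies outside the rectangular
-- hull of q 0 … q l, and lies horizontally or vertically between q l and
-- the rectangular hull of q 0 … q (l-1).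
HBetween VBetween : (ℕ → Point) → ℕ → Point → Set
HBetween q l p =
  (RightOf q l p × px p ℤ.< px (q l)) ⊎ (px (q l) ℤ.< px p × LeftOf q l p)
VBetween q l p =
  (Above q l p × py p ℤ.< py (q l)) ⊎ (py (q l) ℤ.< py p × Below q l p)

ProperPin : (ℕ → Point) → ℕ → Point → Set
ProperPin q l p = OutsideHull q (suc l) p × (HBetween q l p ⊎ VBetween q l p)

data Dir : Set where
  left down right up : Dir

-- directions left, down, right, up, left, … for p_3 , p_4 , …
dirAt : ℕ → Dir
dirAt zero = left
dirAt (suc zero) = down
dirAt (suc (suc zero)) = right
dirAt (suc (suc (suc zero))) = up
dirAt (suc (suc (suc (suc n)))) = dirAt n

HasDir : (ℕ → Point) → ℕ → Point → Dir → Set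
HasDir q m p left  = LeftOf q m p
HasDir q m p down  = Below q m p
HasDir q m p right = RightOf q m p
HasDir q m p up    = Above q m p

StandardSpiral : ℕ → (ℕ → Point) → Set
StandardSpiral k q =
  4 ℕ.≤ k × Generic k q ×
  (px (q 1) ℤ.< px (q 0) × py (q 0) ℤ.< py (q 1)) ×
  (∀ l → suc (suc l) ℕ.< k →
     ProperPin q (suc l) (q (suc (suc l))) ×
     HasDir q (suc (suc l)) (q (suc (suc l))) (dirAt l))

rot90 : Point → Point
rot90 (a , b) = (- b , a)

rotate : ℕ → Point → Point
rotate zero p = p
rotate (suc r) p = rot90 (rotate r p)

PermOf : ∀ {n} → Permutation′ n → (ℕ → Point) → Set
PermOf {n} π q =
  Σ (Fin n → Fin n) λ h → ∀ a b →
    ((px (q (toℕ a)) ℤ.< px (q (toℕ b))) ⇔ (h a Fin.< h b)) ×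
    ((py (q (toℕ a)) ℤ.< py (q (toℕ b))) ⇔ ((π ⟨$⟩ʳ h a) Fin.< (π ⟨$⟩ʳ h b)))

WiddershinsSpiral : ∀ {n} → Permutation′ n → Set
WiddershinsSpiral {n} π =
  Σ (ℕ → Point) λ q → Σ (Fin 4) λ r →
    StandardSpiral n q × PermOf π (λ i → rotate (toℕ r) (q i))

InW : ∀ {k} → Permutation′ k → Set
InW σ = Σ ℕ λ n → Σ (Permutation′ n) λ π → WiddershinsSpiral π × σ ≼ π

record Graph : Set where
  field
    size : ℕ
    adj  : Fin size → Fin size → Bool
open Graph public

permGraph : ∀ {n} → Permutation′ n → Graph
permGraph {n} π = record
  { size = n
  ; adj  = λ i j →
      ((toℕ i <ᵇ toℕ j) ∧ (toℕ (π ⟨$⟩ʳ j) <ᵇ toℕ (π ⟨$⟩ʳ i))) ∨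
      ((toℕ j <ᵇ toℕ i) ∧ (toℕ (π ⟨$⟩ʳ i) <ᵇ toℕ (π ⟨$⟩ʳ j))) }

_≅_ : Graph → Graph → Set
G ≅ H = Σ (Fin (size G) → Fin (size H)) λ f → Σ (Fin (size H) → Fin (size G)) λ g →
  (∀ v → g (f v) ≡ v) × (∀ w → f (g w) ≡ w) ×
  (∀ u v → adj H (f u) (f v) ≡ adj G u v)

InGW : Graph → Set
InGW G = Σ ℕ λ n → Σ (Permutation′ n) λ π → InW π × (G ≅ permGraph π)

record Labelled (X : Set) : Set where
  field
    graph : Graph
    label : Fin (size graph) → X
open Labelled public

LabelledInduced : {X : Set} → (X → X → Set) → Labelled X → Labelled X → Set
LabelledInduced _≤X_ H G =
  Σ (Fin (size (graph H)) → Fin (size (graph G))) λ f →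
    Injective _≡_ _≡_ f ×
    (∀ u v → adj (graph G) (f u) (f v) ≡ adj (graph H) u v) ×
    (∀ v → label H v ≤X label G (f v))

-- labels from a two-element antichain: Bool ordered by equality
_⊑₂_ : Labelled Bool → Labelled Bool → Set
_⊑₂_ = LabelledInduced _≡_

module Submission where

-- The antichain consists of the inversion
-- graphs of the initial segments of 4i+4 points of one explicit spiral, with the
-- vertices 0, 1 and the last vertex 4i+3 labelled `true`.
--
-- A proper pin p for q 0 , … , q m separates q m from the earlier points:
--   it forms an inversion with each earlier point iff it forms none with q m
--   (`pin-separates`); it shares no coordinate with them, so pin sequences are
--   generic (`pins⇒generic`).
-- * The spiral.  Each point from the third on is a proper pin in the widdershins
--   direction, so every initial segment is a standard spiral (`spiral-standard`).
-- * Realisation.  Ranking both coordinates turns a generic point set into a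
--   permutation whose permutation graph is the inversion graph, so every member
--   of the family lies in G_𝒲 (`spiral-inGW`).
-- * Rigidity.  In a separating graph an embedding of an initial segment fixing
--   0 and 1 fixes every vertex (`Rigidity`); the labels force 0 and 1 to be fixed
--   (`Anchoring`).  Hence an embedding of member i into member j sends the
--   labelled vertex 4i+3 to itself, which is labelled in member j only if i = j.

open import Defs
open import Data.Nat as ℕ using (ℕ; zero; suc; _+_; _<_; _≤_; z≤n; s≤s; z<s)
import Data.Nat.Properties as ℕP
open import Data.Integer as ℤ using (ℤ; +_; -[1+_]; -<-; -<+; +<+)
import Data.Integer.Properties as ℤP
open import Data.Bool using (Bool; true; false; not; _∧_; _∨_; _xor_)
open import Data.Bool.Properties using (not-¬; not-involutive; not-distribˡ-xor; xor-comm; ∨-comm; ∨-zeroʳ)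
open import Data.Empty using (⊥; ⊥-elim)
open import Data.Unit using (tt)
open import Data.Fin as Fin using (Fin; toℕ)
import Data.Fin.Properties as FinP
open import Data.Product using (Σ; _×_; _,_; proj₁; proj₂)
open import Data.Sum using (_⊎_; inj₁; inj₂; [_,_]′)
open import Relation.Binary.PropositionalEquality
open import Relation.Binary.Definitions using (tri<; tri≈; tri>)
open import Relation.Nullary using (¬_; Dec; yes; no; does)
open import Relation.Nullary.Decidable using (dec-true; dec-false; does-⇔)
open import Data.Fin.Permutation using (Permutation′; permutation; _⟨$⟩ʳ_; _⟨$⟩ˡ_; inverseˡ; inverseʳ; flip; _∘ₚ_)
open import Function using (_∘_)
open import Function.Bundles using (_⇔_; mk⇔)
open import Function.Construct.Symmetry using (⇔-sym)
open import Function.Construct.Identity using (⇔-id)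
open import Function.Definitions using (Injective)

lt : ℤ → ℤ → Bool
lt x y = does (x ℤP.<? y)

Side : Bool → ℤ → ℤ → Set
Side true  x y = x ℤ.< y
Side false x y = y ℤ.< x

sides-agree : ∀ {b b' x y} → Side b x y → Side b' x y → b ≡ b'
sides-agree {true}  {true}  _ _ = refl
sides-agree {true}  {false} x<y y<x = ⊥-elim (ℤP.<-asym x<y y<x)
sides-agree {false} {true}  y<x x<y = ⊥-elim (ℤP.<-asym x<y y<x)
sides-agree {false} {false} _ _ = refl

Side⇒≢ : ∀ {b x y} → Side b x y → x ≢ y
Side⇒≢ {true}  x<y = ℤP.<⇒≢ x<y
Side⇒≢ {false} y<x = ≢-sym (ℤP.<⇒≢ y<x)

lt-Side : ∀ {b x y} → Side b x y → lt x y ≡ b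
lt-Side {true}  {x} {y} x<y = dec-true (x ℤP.<? y) x<y
lt-Side {false} {x} {y} y<x = dec-false (x ℤP.<? y) (ℤP.<-asym y<x)

lt-Side˘ : ∀ {b x y} → Side b x y → lt y x ≡ not b
lt-Side˘ {true}  {x} {y} x<y = dec-false (y ℤP.<? x) (ℤP.<-asym x<y)
lt-Side˘ {false} {x} {y} y<x = dec-true (y ℤP.<? x) y<x

-- The pair of points (a , b) is an inversion: their x- and y-orders disagree.
-- This is exactly the adjacency of the permutation graph of their plot.
inv : Point → Point → Bool
inv a b = (lt (px a) (px b) ∧ lt (py b) (py a)) ∨ (lt (px b) (px a) ∧ lt (py a) (py b))

inv-sym : ∀ a b → inv a b ≡ inv b a
inv-sym a b = ∨-comm (lt (px a) (px b) ∧ lt (py b) (py a)) (lt (px b) (px a) ∧ lt (py a) (py b))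

inv-sides : ∀ {sx sy a b} → Side sx (px a) (px b) → Side sy (py a) (py b) → inv a b ≡ sx xor sy
inv-sides {sx} {sy} x-side y-side =
  trans (cong₂ _∨_ (cong₂ _∧_ (lt-Side x-side) (lt-Side˘ y-side))
                   (cong₂ _∧_ (lt-Side˘ x-side) (lt-Side y-side)))
        (opposite-sides sx sy)
  where
  opposite-sides : ∀ s t → (s ∧ not t) ∨ (not s ∧ t) ≡ s xor t
  opposite-sides true  true  = refl
  opposite-sides true  false = refl
  opposite-sides false true  = refl
  opposite-sides false false = refl

data Axes : (Point → ℤ) → (Point → ℤ) → Set where
  horizontal : Axes px py
  vertical   : Axes py px

inv-along : ∀ {c d s t a b} → Axes c d → Side s (c a) (c b) → Side t (d a) (d b) → inv a b ≡ s xor t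
inv-along horizontal c-side d-side = inv-sides c-side d-side
inv-along {s = s} {t} vertical   c-side d-side = trans (inv-sides d-side c-side) (xor-comm t s)

Apart : Point → Point → Set
Apart a b = (px a ≢ px b) × (py a ≢ py b)

apart-along : ∀ {c d a b} → Axes c d → c a ≢ c b → d a ≢ d b → Apart a b
apart-along horizontal c≢ d≢ = c≢ , d≢
apart-along vertical   c≢ d≢ = d≢ , c≢

-- Along the coordinate c, p lies on side s of each of q 0 , … , q (m-1).
-- `Beyond px false` is `LeftOf`, `Beyond px true` is `RightOf`,
-- `Beyond py true` is `Above` and `Beyond py false` is `Below`.
Beyond : (Point → ℤ) → Bool → (ℕ → Point) → ℕ → Point → Set
Beyond c s q m p = ∀ j → j < m → Side s (c (q j)) (c p)

-- The geometric content of a proper pin p for q 0 , … , q m: along one axis it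
-- separates the earlier points q 0 , … , q (m-1) from the last point q m, and
-- along the other axis it lies beyond all of q 0 , … , q m on a single side.
record PinShape (q : ℕ → Point) (m : ℕ) (p : Point) : Set where
  constructor pinShape
  field
    {along across} : Point → ℤ
    axes           : Axes along across
    side           : Bool
    separatesEarlier : Beyond along side q m p
    separatesLast    : Side (not side) (along (q m)) (along p)
    outside        : Σ Bool λ t → Beyond across t q (suc m) p

separating⇒¬beyond : ∀ {c s b q l p} → Beyond c s q (suc l) p →
  Side (not s) (c (q (suc l))) (c p) → ¬ Beyond c b q (suc (suc l)) p
separating⇒¬beyond {s = s} earlier last beyond =
  not-¬ {s} refl (trans (sym (sides-agree (beyond 0 z<s) (earlier 0 z<s)))
                        (sides-agree (beyond _ ℕP.≤-refl) last))

outside-across : ∀ {c d s q l p} → Axes c d → Beyond c s q (suc l) p →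
  Side (not s) (c (q (suc l))) (c p) → OutsideHull q (suc (suc l)) p →
  Σ Bool λ t → Beyond d t q (suc (suc l)) p
outside-across {s = s} {q} {l} {p} horizontal earlier last (inj₁ leftOf) =
  ⊥-elim (separating⇒¬beyond {px} {s} {false} {q} {l} {p} earlier last leftOf)
outside-across {s = s} {q} {l} {p} horizontal earlier last (inj₂ (inj₁ rightOf)) =
  ⊥-elim (separating⇒¬beyond {px} {s} {true} {q} {l} {p} earlier last rightOf)
outside-across horizontal earlier last (inj₂ (inj₂ (inj₁ above))) = true , above
outside-across horizontal earlier last (inj₂ (inj₂ (inj₂ below))) = false , below
outside-across vertical earlier last (inj₁ leftOf) = false , leftOf
outside-across vertical earlier last (inj₂ (inj₁ rightOf)) = true , rightOf
outside-across {s = s} {q} {l} {p} vertical earlier last (inj₂ (inj₂ (inj₁ above))) =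
  ⊥-elim (separating⇒¬beyond {py} {s} {true} {q} {l} {p} earlier last above)
outside-across {s = s} {q} {l} {p} vertical earlier last (inj₂ (inj₂ (inj₂ below))) =
  ⊥-elim (separating⇒¬beyond {py} {s} {false} {q} {l} {p} earlier last below)

properPin⇒shape : ∀ {q l p} → ProperPin q (suc l) p → PinShape q (suc l) p
properPin⇒shape (out , inj₁ (inj₁ (rightOf , left-of-last))) =
  pinShape horizontal true rightOf left-of-last (outside-across {s = true} horizontal rightOf left-of-last out)
properPin⇒shape (out , inj₁ (inj₂ (right-of-last , leftOf))) =
  pinShape horizontal false leftOf right-of-last (outside-across {s = false} horizontal leftOf right-of-last out)
properPin⇒shape (out , inj₂ (inj₁ (above , below-last))) =
  pinShape vertical true above below-last (outside-across {s = true} vertical above below-last out)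
properPin⇒shape (out , inj₂ (inj₂ (above-last , below))) =
  pinShape vertical false below above-last (outside-across {s = false} vertical below above-last out)

pin-separates : ∀ {q m p} → PinShape q m p → ∀ j → j < m → inv (q j) p ≡ not (inv (q m) p)
pin-separates {q} {m} {p} (pinShape axes s earlier last (t , beyond)) j j<m = begin
  inv (q j) p          ≡⟨ inv-along axes (earlier j j<m) (beyond j (ℕP.m<n⇒m<1+n j<m)) ⟩
  s xor t              ≡⟨ cong (_xor t) (sym (not-involutive s)) ⟩
  not (not s) xor t    ≡⟨ sym (not-distribˡ-xor (not s) t) ⟩
  not (not s xor t)    ≡⟨ cong not (sym (inv-along axes last (beyond m ℕP.≤-refl))) ⟩
  not (inv (q m) p)    ∎
  where open ≡-Reasoning

pin-apart : ∀ {q m p} → PinShape q m p → ∀ j → j < suc m → Apart (q j) p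
pin-apart {m = m} (pinShape axes s earlier last (t , beyond)) j j<1+m
  with ℕP.m<1+n⇒m<n∨m≡n j<1+m
... | inj₁ j<m  = apart-along axes (Side⇒≢ (earlier j j<m)) (Side⇒≢ (beyond j j<1+m))
... | inj₂ refl = apart-along axes (Side⇒≢ last) (Side⇒≢ (beyond m j<1+m))

pins⇒earlier-apart : ∀ {q} → (∀ l → PinShape q (suc l) (q (suc (suc l)))) →
  Apart (q 0) (q 1) → ∀ i j → i < j → Apart (q i) (q j)
pins⇒earlier-apart shape apart₀₁ zero (suc zero) _ = apart₀₁
pins⇒earlier-apart shape apart₀₁ (suc i) (suc zero) (s≤s ())
pins⇒earlier-apart shape apart₀₁ i (suc (suc l)) i<j = pin-apart (shape l) i i<j

pins⇒generic : ∀ {q} → (∀ l → PinShape q (suc l) (q (suc (suc l)))) → Apart (q 0) (q 1) →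
  ∀ k → Generic k q
pins⇒generic shape apart₀₁ k i j _ _ i≢j with ℕP.<-cmp i j
... | tri< i<j _ _ = pins⇒earlier-apart shape apart₀₁ i j i<j
... | tri≈ _ i≡j _ = ⊥-elim (i≢j i≡j)
... | tri> _ _ j<i = let (x≢ , y≢) = pins⇒earlier-apart shape apart₀₁ j i j<i in ≢-sym x≢ , ≢-sym y≢

-- Its points come in turns of four: the point
-- with index offset a + 4t lies on arm a in turn t, and each turn is the previous
-- one pushed two units outwards along both axes.
quad double : ℕ → ℕ
quad zero    = zero
quad (suc t) = suc (suc (suc (suc (quad t))))
double zero    = zero
double (suc t) = suc (suc (double t))

data Arm : Set where
  east north west south : Arm

offset : Arm → ℕ
offset east  = 0
offset north = 1
offset west  = 2
offset south = 3

point : Arm → ℕ → Point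
point east  t = + suc (suc (double t)) , -[1+ double t ]
point north t = + suc (double t)       , + suc (suc (double t))
point west  t = -[1+ suc (double t) ]  , + suc (double t)
point south t = -[1+ double t ]        , -[1+ suc (suc (suc (double t))) ]

expand : ℤ → ℤ
expand (+ n)    = + suc (suc n)
expand -[1+ n ] = -[1+ suc (suc n) ]

spiral : ℕ → Point
spiral 0 = point east 0
spiral 1 = point north 0
spiral 2 = point west 0
spiral 3 = point south 0
spiral (suc (suc (suc (suc j)))) = expand (px (spiral j)) , expand (py (spiral j))

spiral-point : ∀ a t → spiral (offset a + quad t) ≡ point a t
spiral-point east  zero    = refl
spiral-point north zero    = refl
spiral-point west  zero    = refl
spiral-point south zero    = refl
spiral-point east  (suc t) = cong (λ p → expand (px p) , expand (py p)) (spiral-point east t)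
spiral-point north (suc t) = cong (λ p → expand (px p) , expand (py p)) (spiral-point north t)
spiral-point west  (suc t) = cong (λ p → expand (px p) , expand (py p)) (spiral-point west t)
spiral-point south (suc t) = cong (λ p → expand (px p) , expand (py p)) (spiral-point south t)

data Position : ℕ → Set where
  at : ∀ a t → Position (offset a + quad t)

position : ∀ j → Position j
position 0 = at east 0
position 1 = at north 0
position 2 = at west 0
position 3 = at south 0
position (suc (suc (suc (suc j)))) with position j
... | at east  t = at east  (suc t)
... | at north t = at north (suc t)
... | at west  t = at west  (suc t)
... | at south t = at south (suc t)

Earlier : Arm → ℕ → Arm → ℕ → Set
Earlier a' t' a t = t' < t ⊎ (t' ≡ t × offset a' < offset a)

offset<4 : ∀ a → offset a < 4
offset<4 east  = s≤s z≤n
offset<4 north = s≤s (s≤s z≤n)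
offset<4 west  = s≤s (s≤s (s≤s z≤n))
offset<4 south = ℕP.≤-refl

quad-lex : ∀ t t' i i' → i < 4 → i' < 4 → quad t + i < quad t' + i' →
  t < t' ⊎ (t ≡ t' × i < i')
quad-lex zero zero i i' _ _ i<i' = inj₂ (refl , i<i')
quad-lex zero (suc t') i i' _ _ _ = inj₁ z<s
quad-lex (suc t) zero i i' _ i'<4 lt =
  ⊥-elim (ℕP.<⇒≱ i'<4 (ℕP.≤-trans (ℕP.m≤m+n 4 (quad t + i)) (ℕP.<⇒≤ lt)))
quad-lex (suc t) (suc t') i i' i<4 i'<4 (s≤s (s≤s (s≤s (s≤s lt)))) with quad-lex t t' i i' i<4 i'<4 lt
... | inj₁ t<t'          = inj₁ (s≤s t<t')
... | inj₂ (refl , i<i') = inj₂ (refl , i<i')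

earlier : ∀ a' t' a t → offset a' + quad t' < offset a + quad t → Earlier a' t' a t
earlier a' t' a t lt
  rewrite ℕP.+-comm (offset a') (quad t') | ℕP.+-comm (offset a) (quad t) =
  quad-lex t' t (offset a') (offset a) (offset<4 a') (offset<4 a) lt

before : (P : Point → Set) → ∀ a t → (∀ a' t' → Earlier a' t' a t → P (point a' t')) →
  ∀ j → j < offset a + quad t → P (spiral j)
before P a t bound j j<at with position j
... | at a' t' = subst P (sym (spiral-point a' t')) (bound a' t' (earlier a' t' a t j<at))

double-mono : ∀ {t s} → t ≤ s → double t ≤ double s
double-mono z≤n       = z≤n
double-mono (s≤s t≤s) = s≤s (s≤s (double-mono t≤s))

double-strict : ∀ {t s} → t < s → double t < double s
double-strict t<s = ℕP.≤-trans (ℕP.n≤1+n _) (double-mono t<s)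

turn-≤ : ∀ {t' t} {A : Set} → t' < t ⊎ (t' ≡ t × A) → t' ≤ t
turn-≤ (inj₁ t'<t)      = ℕP.<⇒≤ t'<t
turn-≤ (inj₂ (refl , _)) = ℕP.≤-refl

-- The four kinds of pins of the spiral, each compared with all earlier points:
-- the point of turn t on the west arm is a left pin, on the south arm a down pin,
-- and the points of turn t+1 on the east and north arms are right and up pins.
west-leftOf : ∀ t → LeftOf spiral (2 + quad t) (point west t)
west-leftOf t = before (λ p → px (point west t) ℤ.< px p) west t bound
  where
  bound : ∀ a' t' → Earlier a' t' west t → px (point west t) ℤ.< px (point a' t')
  bound east  t' _ = -<+
  bound north t' _ = -<+
  bound west  t' (inj₁ t'<t) = -<- (s≤s (double-strict t'<t))
  bound west  t' (inj₂ (_ , s≤s (s≤s ())))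
  bound south t' (inj₁ t'<t) = -<- (s≤s (double-mono (ℕP.<⇒≤ t'<t)))
  bound south t' (inj₂ (_ , s≤s (s≤s ())))

west-above : ∀ t → Above spiral (1 + quad t) (point west t)
west-above t = before (λ p → py p ℤ.< py (point west t)) north t bound
  where
  bound : ∀ a' t' → Earlier a' t' north t → py (point a' t') ℤ.< py (point west t)
  bound east  t' _ = -<+
  bound south t' _ = -<+
  bound north t' (inj₁ t'<t) = +<+ (s≤s (double-mono t'<t))
  bound north t' (inj₂ (_ , s≤s ()))
  bound west  t' (inj₁ t'<t) = +<+ (s≤s (double-strict t'<t))
  bound west  t' (inj₂ (_ , s≤s ()))

south-below : ∀ t → Below spiral (3 + quad t) (point south t)
south-below t = before (λ p → py (point south t) ℤ.< py p) south t bound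
  where
  bound : ∀ a' t' → Earlier a' t' south t → py (point south t) ℤ.< py (point a' t')
  bound north t' _ = -<+
  bound west  t' _ = -<+
  bound east  t' e = -<- (s≤s (ℕP.m≤n⇒m≤o+n 2 (double-mono (turn-≤ e))))
  bound south t' (inj₁ t'<t) = -<- (s≤s (s≤s (s≤s (double-strict t'<t))))
  bound south t' (inj₂ (_ , s≤s (s≤s (s≤s ()))))

south-leftOf : ∀ t → LeftOf spiral (2 + quad t) (point south t)
south-leftOf t = before (λ p → px (point south t) ℤ.< px p) west t bound
  where
  bound : ∀ a' t' → Earlier a' t' west t → px (point south t) ℤ.< px (point a' t')
  bound east  t' _ = -<+
  bound north t' _ = -<+
  bound west  t' (inj₁ t'<t) = -<- (double-mono t'<t)
  bound west  t' (inj₂ (_ , s≤s (s≤s ())))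
  bound south t' (inj₁ t'<t) = -<- (double-strict t'<t)
  bound south t' (inj₂ (_ , s≤s (s≤s ())))

east-rightOf : ∀ t → RightOf spiral (quad (suc t)) (point east (suc t))
east-rightOf t = before (λ p → px p ℤ.< px (point east (suc t))) east (suc t) bound
  where
  bound : ∀ a' t' → Earlier a' t' east (suc t) → px (point a' t') ℤ.< px (point east (suc t))
  bound west  t' _ = -<+
  bound south t' _ = -<+
  bound east  t' (inj₁ t'<1+t) = +<+ (s≤s (s≤s (s≤s (ℕP.m≤n⇒m≤1+n (double-mono (ℕ.s≤s⁻¹ t'<1+t))))))
  bound east  t' (inj₂ (_ , ()))
  bound north t' (inj₁ t'<1+t) = +<+ (s≤s (s≤s (ℕP.m≤n⇒m≤o+n 2 (double-mono (ℕ.s≤s⁻¹ t'<1+t)))))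
  bound north t' (inj₂ (_ , ()))

east-below : ∀ t → Below spiral (3 + quad t) (point east (suc t))
east-below t = before (λ p → py (point east (suc t)) ℤ.< py p) south t bound
  where
  bound : ∀ a' t' → Earlier a' t' south t → py (point east (suc t)) ℤ.< py (point a' t')
  bound north t' _ = -<+
  bound west  t' _ = -<+
  bound east  t' e = -<- (s≤s (ℕP.m≤n⇒m≤1+n (double-mono (turn-≤ e))))
  bound south t' (inj₁ t'<t) = -<- (s≤s (s≤s (double-mono t'<t)))
  bound south t' (inj₂ (_ , s≤s (s≤s (s≤s ()))))

north-above : ∀ t → Above spiral (1 + quad (suc t)) (point north (suc t))
north-above t = before (λ p → py p ℤ.< py (point north (suc t))) north (suc t) bound
  where
  bound : ∀ a' t' → Earlier a' t' north (suc t) → py (point a' t') ℤ.< py (point north (suc t))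
  bound east  t' _ = -<+
  bound south t' _ = -<+
  bound north t' (inj₁ t'<1+t) = +<+ (s≤s (s≤s (s≤s (ℕP.m≤n⇒m≤1+n (double-mono (ℕ.s≤s⁻¹ t'<1+t))))))
  bound north t' (inj₂ (_ , s≤s ()))
  bound west  t' (inj₁ t'<1+t) = +<+ (s≤s (s≤s (ℕP.m≤n⇒m≤o+n 2 (double-mono (ℕ.s≤s⁻¹ t'<1+t)))))
  bound west  t' (inj₂ (_ , s≤s ()))

north-rightOf : ∀ t → RightOf spiral (quad (suc t)) (point north (suc t))
north-rightOf t = before (λ p → px p ℤ.< px (point north (suc t))) east (suc t) bound
  where
  bound : ∀ a' t' → Earlier a' t' east (suc t) → px (point a' t') ℤ.< px (point north (suc t))
  bound west  t' _ = -<+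
  bound south t' _ = -<+
  bound east  t' (inj₁ t'<1+t) = +<+ (s≤s (s≤s (s≤s (double-mono (ℕ.s≤s⁻¹ t'<1+t)))))
  bound east  t' (inj₂ (_ , ()))
  bound north t' (inj₁ t'<1+t) = +<+ (s≤s (s≤s (ℕP.m≤n⇒m≤1+n (double-mono (ℕ.s≤s⁻¹ t'<1+t)))))
  bound north t' (inj₂ (_ , ()))

dirAt-turn : ∀ a t → dirAt (offset a + quad t) ≡ dirAt (offset a)
dirAt-turn a t = trans (cong dirAt (ℕP.+-comm (offset a) (quad t))) (periodic (offset a) t)
  where
  periodic : ∀ n t → dirAt (quad t + n) ≡ dirAt n
  periodic n zero    = refl
  periodic n (suc t) = periodic n t

spiral-pin : ∀ l → ProperPin spiral (suc l) (spiral (2 + l)) ×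
                   HasDir spiral (2 + l) (spiral (2 + l)) (dirAt l)
spiral-pin l with position l
... | at east t rewrite dirAt-turn east t | spiral-point west t | spiral-point north t =
  (inj₁ (west-leftOf t) , inj₂ (inj₁ (west-above t , +<+ ℕP.≤-refl))) , west-leftOf t
... | at north t rewrite dirAt-turn north t | spiral-point south t | spiral-point west t =
  (inj₂ (inj₂ (inj₂ (south-below t))) , inj₁ (inj₂ (-<- ℕP.≤-refl , south-leftOf t))) , south-below t
... | at west t rewrite dirAt-turn west t | spiral-point east t | spiral-point south t =
  (inj₂ (inj₁ (east-rightOf t)) , inj₂ (inj₂ (-<- ℕP.≤-refl , east-below t))) , east-rightOf t
... | at south t rewrite dirAt-turn south t | spiral-point north t | spiral-point east t =
  (inj₂ (inj₂ (inj₁ (north-above t))) , inj₁ (inj₁ (north-rightOf t , +<+ ℕP.≤-refl))) , north-above t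

spiral-shape : ∀ l → PinShape spiral (suc l) (spiral (2 + l))
spiral-shape l = properPin⇒shape (proj₁ (spiral-pin l))

spiral-standard : ∀ k → 4 ≤ k → StandardSpiral k spiral
spiral-standard k 4≤k =
  4≤k , pins⇒generic spiral-shape ((λ ()) , (λ ())) k , (+<+ (s≤s (s≤s z≤n)) , -<+) ,
  λ l _ → spiral-pin l

indicator : ∀ {A : Set} → Dec A → ℕ
indicator (yes _) = 1
indicator (no _)  = 0

count : ∀ {n} {P : Fin n → Set} → (∀ a → Dec (P a)) → ℕ
count {zero}  P? = 0
count {suc n} P? = indicator (P? Fin.zero) + count (λ a → P? (Fin.suc a))

indicator-mono : ∀ {A B : Set} (a? : Dec A) (b? : Dec B) → (A → B) → indicator a? ≤ indicator b?
indicator-mono (yes a) (yes _) _   = ℕP.≤-refl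
indicator-mono (yes a) (no ¬b) A→B = ⊥-elim (¬b (A→B a))
indicator-mono (no _)  _       _   = z≤n

count-mono : ∀ {n} {P R : Fin n → Set} (P? : ∀ a → Dec (P a)) (R? : ∀ a → Dec (R a)) →
  (∀ a → P a → R a) → count P? ≤ count R?
count-mono {zero}  P? R? P⊆R = z≤n
count-mono {suc n} P? R? P⊆R =
  ℕP.+-mono-≤ (indicator-mono (P? Fin.zero) (R? Fin.zero) (P⊆R Fin.zero))
              (count-mono (λ a → P? (Fin.suc a)) (λ a → R? (Fin.suc a)) (λ a → P⊆R (Fin.suc a)))

count-strict : ∀ {n} {P R : Fin n → Set} (P? : ∀ a → Dec (P a)) (R? : ∀ a → Dec (R a)) →
  (∀ a → P a → R a) → ∀ a → R a → ¬ P a → count P? < count R?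
count-strict P? R? P⊆R Fin.zero r ¬p with P? Fin.zero | R? Fin.zero
... | yes p | _     = ⊥-elim (¬p p)
... | no _  | no ¬r = ⊥-elim (¬r r)
... | no _  | yes _ =
  s≤s (count-mono (λ a → P? (Fin.suc a)) (λ a → R? (Fin.suc a)) (λ a → P⊆R (Fin.suc a)))
count-strict P? R? P⊆R (Fin.suc a) r ¬p =
  ℕP.+-mono-≤-< (indicator-mono (P? Fin.zero) (R? Fin.zero) (P⊆R Fin.zero))
                (count-strict (λ a → P? (Fin.suc a)) (λ a → R? (Fin.suc a)) (λ a → P⊆R (Fin.suc a)) a r ¬p)

count-all : ∀ n → count {n} (λ _ → yes tt) ≡ n
count-all zero    = refl
count-all (suc n) = cong suc (count-all n)

injective⇒surjective : ∀ {n} (h : Fin n → Fin n) → Injective _≡_ _≡_ h → ∀ y → Σ (Fin n) λ x → h x ≡ y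
injective⇒surjective {suc m} h h-inj y with FinP.any? (λ x → h x FinP.≟ y)
... | yes hit = hit
... | no miss = ⊥-elim (ℕP.<-irrefl refl (FinP.injective⇒≤ squeeze-injective))
  where
  avoids : ∀ x → y ≢ h x
  avoids x y≡hx = miss (x , sym y≡hx)
  squeeze : Fin (suc m) → Fin m
  squeeze x = Fin.punchOut (avoids x)
  squeeze-injective : Injective _≡_ _≡_ squeeze
  squeeze-injective eq = h-inj (FinP.punchOut-injective (avoids _) (avoids _) eq)

injection⇒permutation : ∀ {n} (h : Fin n → Fin n) → Injective _≡_ _≡_ h → Permutation′ n
injection⇒permutation {n} h h-inj = permutation h preimage
  (λ y → proj₂ (injective⇒surjective h h-inj y))
  (λ x → h-inj (proj₂ (injective⇒surjective h h-inj (h x))))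
  where
  preimage : Fin n → Fin n
  preimage y = proj₁ (injective⇒surjective h h-inj y)

module Ranking {n : ℕ} (X : Fin n → ℤ) (X-injective : Injective _≡_ _≡_ X) where

  rank : Fin n → ℕ
  rank a = count (λ b → X b ℤP.<? X a)

  rank-mono : ∀ {a b} → X a ℤ.< X b → rank a < rank b
  rank-mono {a} {b} a<b = count-strict (λ c → X c ℤP.<? X a) (λ c → X c ℤP.<? X b)
    (λ c c<a → ℤP.<-trans c<a a<b) a a<b (ℤP.<-irrefl refl)

  rank<n : ∀ a → rank a < n
  rank<n a = subst (rank a <_) (count-all n)
    (count-strict (λ c → X c ℤP.<? X a) (λ _ → yes tt) (λ _ _ → tt) a tt (ℤP.<-irrefl refl))

  rk : Fin n → Fin n
  rk a = Fin.fromℕ< (rank<n a)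

  toℕ-rk : ∀ a → toℕ (rk a) ≡ rank a
  toℕ-rk a = FinP.toℕ-fromℕ< (rank<n a)

  rk-mono : ∀ {a b} → X a ℤ.< X b → rk a Fin.< rk b
  rk-mono {a} {b} a<b = subst₂ _<_ (sym (toℕ-rk a)) (sym (toℕ-rk b)) (rank-mono a<b)

  rk-order : ∀ a b → (X a ℤ.< X b) ⇔ (rk a Fin.< rk b)
  rk-order a b = mk⇔ rk-mono reflect
    where
    reflect : rk a Fin.< rk b → X a ℤ.< X b
    reflect ra<rb with ℤP.<-cmp (X a) (X b)
    ... | tri< a<b _ _ = a<b
    ... | tri≈ _ a≡b _ = ⊥-elim (ℕP.<-irrefl (cong (toℕ ∘ rk) (X-injective a≡b)) ra<rb)
    ... | tri> _ _ b<a = ⊥-elim (ℕP.<-asym ra<rb (rk-mono b<a))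

  rk-injective : Injective _≡_ _≡_ rk
  rk-injective {a} {b} ra≡rb with ℤP.<-cmp (X a) (X b)
  ... | tri< a<b _ _ = ⊥-elim (ℕP.<-irrefl (cong toℕ ra≡rb) (rk-mono a<b))
  ... | tri≈ _ a≡b _ = X-injective a≡b
  ... | tri> _ _ b<a = ⊥-elim (ℕP.<-irrefl (cong toℕ (sym ra≡rb)) (rk-mono b<a))

  rk-<ᵇ : ∀ a b → (toℕ (rk a) ℕ.<ᵇ toℕ (rk b)) ≡ lt (X a) (X b)
  rk-<ᵇ a b = does-⇔ (⇔-sym (rk-order a b)) (toℕ (rk a) ℕP.<? toℕ (rk b)) (X a ℤP.<? X b)

  ranking : Permutation′ n
  ranking = injection⇒permutation rk rk-injective

pointGraph : (ℕ → Point) → ℕ → Graph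
pointGraph q n = record { size = n ; adj = λ u v → inv (q (toℕ u)) (q (toℕ v)) }

generic-injective : ∀ {n q} (c : Point → ℤ) → (∀ {a b} → Apart a b → c a ≢ c b) →
  Generic n q → Injective _≡_ _≡_ (λ (a : Fin n) → c (q (toℕ a)))
generic-injective {n} {q} c select generic {a} {b} ca≡cb with a FinP.≟ b
... | yes a≡b = a≡b
... | no  a≢b = ⊥-elim (select (generic (toℕ a) (toℕ b) (FinP.toℕ<n a) (FinP.toℕ<n b)
                                        (a≢b ∘ FinP.toℕ-injective)) ca≡cb)

-- A generic point set is the plot of a permutation π (ranking it in both
-- coordinates), and its inversion graph is the permutation graph of π.
module Realisation (q : ℕ → Point) (n : ℕ) (generic : Generic n q) where

  X Y : Fin n → ℤ
  X a = px (q (toℕ a))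
  Y a = py (q (toℕ a))

  module RX = Ranking X (generic-injective px proj₁ generic)
  module RY = Ranking Y (generic-injective py proj₂ generic)

  π : Permutation′ n
  π = flip RX.ranking ∘ₚ RY.ranking

  π-rank : ∀ a → π ⟨$⟩ʳ RX.rk a ≡ RY.rk a
  π-rank a = cong RY.rk (inverseˡ RX.ranking)

  permOf : PermOf π q
  permOf = RX.rk , λ a b → RX.rk-order a b ,
    subst₂ (λ u v → (Y a ℤ.< Y b) ⇔ (u Fin.< v)) (sym (π-rank a)) (sym (π-rank b)) (RY.rk-order a b)

  adjacency : ∀ u v → adj (permGraph π) (RX.rk u) (RX.rk v) ≡ adj (pointGraph q n) u v
  adjacency u v rewrite π-rank u | π-rank v =
    cong₂ _∨_ (cong₂ _∧_ (RX.rk-<ᵇ u v) (RY.rk-<ᵇ v u)) (cong₂ _∧_ (RX.rk-<ᵇ v u) (RY.rk-<ᵇ u v))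

  iso : pointGraph q n ≅ permGraph π
  iso = RX.rk , RX.ranking ⟨$⟩ˡ_ , (λ _ → inverseˡ RX.ranking) , (λ _ → inverseʳ RX.ranking) , adjacency

-- Every initial segment of at least four points of the spiral has its
-- inversion graph in G_𝒲: it is the graph of the spiral permutation itself.
spiral-inGW : ∀ n → 4 ≤ n → InGW (pointGraph spiral n)
spiral-inGW n 4≤n = n , π , (n , π , (spiral , Fin.zero , standard , permOf) , ≼-refl) , iso
  where
  standard : StandardSpiral n spiral
  standard = spiral-standard n 4≤n
  open Realisation spiral n (proj₁ (proj₂ standard))
  ≼-refl : π ≼ π
  ≼-refl = (λ a → a) , (λ _ _ a<b → a<b) , (λ _ _ → ⇔-id _)

-- This is the graph-theoretic shadow of a pin sequence.
Separating : (ℕ → ℕ → Bool) → Set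
Separating E = ∀ m j → j < m → E j (suc m) ≡ not (E m (suc m))

separating-uniform : ∀ {E} → Separating E → ∀ {m i j} → i < m → j < m → E i (suc m) ≡ E j (suc m)
separating-uniform separating {m} {i} {j} i<m j<m =
  trans (separating m i i<m) (sym (separating m j j<m))

-- The vertices l and l+1 tell the vertex l+2 apart from every later vertex w:
-- w treats them alike, while l+2 treats them differently.
separating-distinguishes : ∀ {E} → Separating E → ∀ {l w} → 2 + l < w →
  E l (2 + l) ≡ E l w → E (suc l) (2 + l) ≡ E (suc l) w → ⊥
separating-distinguishes {E} separating {l} {suc w} (s≤s 1+l<w) agree₀ agree₁ =
  not-¬ same (separating (suc l) l ℕP.≤-refl)
  where
  same : E l (2 + l) ≡ E (suc l) (2 + l)
  same = trans agree₀ (trans (separating-uniform {E} separating (ℕP.<-trans ℕP.≤-refl 1+l<w) 1+l<w)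
                             (sym agree₁))

vertexAt : ∀ {n} m → m < n → Σ (Fin n) λ u → toℕ u ≡ m
vertexAt m m<n = Fin.fromℕ< m<n , FinP.toℕ-fromℕ< m<n

-- By strong induction: a vertex cannot go
-- down (its image is already the image of a smaller vertex), nor up (by
-- `separating-distinguishes` with the already fixed vertices l and l+1).
module Rigidity {E : ℕ → ℕ → Bool} (separating : Separating E) {n n' : ℕ}
  (f : Fin n → Fin n') (f-injective : Injective _≡_ _≡_ f)
  (f-preserves : ∀ u v → E (toℕ (f u)) (toℕ (f v)) ≡ E (toℕ u) (toℕ v))
  (f-anchored : ∀ v → toℕ v ≤ 1 → toℕ (f v) ≡ toℕ v) where

  F : Fin n → ℕ
  F v = toℕ (f v)

  FixedBelow : ℕ → Set
  FixedBelow k = ∀ v → toℕ v < k → F v ≡ toℕ v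

  not-lowered : ∀ {v} → FixedBelow (toℕ v) → ¬ (F v < toℕ v)
  not-lowered {v} fixed Fv<v = ℕP.<-irrefl (sym (trans (cong toℕ v≡u) tu)) Fv<v
    where
    u : Fin n
    u = proj₁ (vertexAt (F v) (ℕP.<-trans Fv<v (FinP.toℕ<n v)))
    tu : toℕ u ≡ F v
    tu = proj₂ (vertexAt (F v) (ℕP.<-trans Fv<v (FinP.toℕ<n v)))
    v≡u : v ≡ u
    v≡u = f-injective (FinP.toℕ-injective
            (sym (trans (fixed u (subst (_< toℕ v) (sym tu) Fv<v)) tu)))

  not-raised : ∀ {v l} → toℕ v ≡ 2 + l → FixedBelow (toℕ v) → ¬ (toℕ v < F v)
  not-raised {v} {l} v≡2+l fixed v<Fv =
    separating-distinguishes {E} separating (subst (_< F v) v≡2+l v<Fv)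
      (agree l (ℕP.<-trans ℕP.≤-refl l+1<v)) (agree (suc l) l+1<v)
    where
    l+1<v : suc l < toℕ v
    l+1<v = subst (suc l <_) (sym v≡2+l) ℕP.≤-refl
    agree : ∀ i → i < toℕ v → E i (2 + l) ≡ E i (F v)
    agree i i<v with vertexAt i (ℕP.<-trans i<v (FinP.toℕ<n v))
    ... | u , refl = begin
      E (toℕ u) (2 + l)         ≡⟨ cong (E (toℕ u)) (sym v≡2+l) ⟩
      E (toℕ u) (toℕ v)         ≡⟨ sym (f-preserves u v) ⟩
      E (F u) (F v)             ≡⟨ cong (λ x → E x (F v)) (fixed u i<v) ⟩
      E (toℕ u) (F v)           ∎
      where open ≡-Reasoning

  low-or-high : ∀ k → k ≤ 1 ⊎ Σ ℕ λ l → k ≡ 2 + l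
  low-or-high 0 = inj₁ z≤n
  low-or-high 1 = inj₁ (s≤s z≤n)
  low-or-high (suc (suc l)) = inj₂ (l , refl)

  fixed-at : ∀ v → FixedBelow (toℕ v) → F v ≡ toℕ v
  fixed-at v fixed with low-or-high (toℕ v)
  ... | inj₁ v≤1 = f-anchored v v≤1
  ... | inj₂ (l , v≡2+l) with ℕP.<-cmp (F v) (toℕ v)
  ...   | tri< lowered _ _ = ⊥-elim (not-lowered fixed lowered)
  ...   | tri≈ _ same _    = same
  ...   | tri> _ _ raised  = ⊥-elim (not-raised v≡2+l fixed raised)

  fixed-below : ∀ k → FixedBelow k
  fixed-below zero v ()
  fixed-below (suc k) v v<1+k with ℕP.m<1+n⇒m<n∨m≡n v<1+k
  ... | inj₁ v<k  = fixed-below k v v<k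
  ... | inj₂ refl = fixed-at v (fixed-below k)

  fixed : ∀ v → F v ≡ toℕ v
  fixed v = fixed-below (suc (toℕ v)) v ℕP.≤-refl

-- The labelled vertices of the antichain members: 0, 1 and the last vertex L.
Anchor : ℕ → ℕ → Set
Anchor L x = x ≤ 1 ⊎ x ≡ L

module Anchoring {E : ℕ → ℕ → Bool} (separating : Separating E)
  (symmetric : ∀ a b → E a b ≡ E b a) (m : ℕ)
  (first-edge : E 0 1 ≡ true) (last-isolated : E 0 (3 + m) ≡ false) where

  isolated : ∀ {x} → x ≤ 1 → E x (3 + m) ≡ false
  isolated z≤n       = last-isolated
  isolated (s≤s z≤n) = trans (separating-uniform {E} separating (s≤s (s≤s z≤n)) (s≤s z≤n)) last-isolated

  no-edge-to-last : ∀ {x} → x ≤ 1 → E x (3 + m) ≢ E 0 1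
  no-edge-to-last x≤1 e with trans (sym (isolated x≤1)) (trans e first-edge)
  ... | ()

  -- 1 , 0 cannot be followed by a vertex c seeing them as 2 sees 0 , 1:
  -- 2 sees 0 and 1 differently, while every vertex after 2 sees them alike.
  not-reversed : ∀ c → c ≢ 0 → c ≢ 1 → E 1 c ≡ E 0 2 → E 0 c ≡ E 1 2 → ⊥
  not-reversed 0 c≢0 _ _ _ = c≢0 refl
  not-reversed 1 _ c≢1 _ _ = c≢1 refl
  not-reversed 2 _ _ e₁ _  = not-¬ (sym e₁) (separating 1 0 (s≤s z≤n))
  not-reversed (suc (suc (suc x))) _ _ e₁ e₀ =
    not-¬ (trans (sym e₁) (trans (separating-uniform {E} separating (s≤s (s≤s z≤n)) (s≤s z≤n)) e₀))
          (separating 1 0 (s≤s z≤n))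

  anchors-fixed : ∀ {a b c} → Anchor (3 + m) a → Anchor (3 + m) b → a ≢ b → c ≢ a → c ≢ b →
    E a b ≡ E 0 1 → E a c ≡ E 0 2 → E b c ≡ E 1 2 → a ≡ 0 × b ≡ 1
  anchors-fixed (inj₁ z≤n)       (inj₁ (s≤s z≤n)) _ _ _ _ _ _ = refl , refl
  anchors-fixed (inj₁ z≤n)       (inj₁ z≤n)       a≢b _ _ _ _ _ = ⊥-elim (a≢b refl)
  anchors-fixed (inj₁ (s≤s z≤n)) (inj₁ (s≤s z≤n)) a≢b _ _ _ _ _ = ⊥-elim (a≢b refl)
  anchors-fixed (inj₁ (s≤s z≤n)) (inj₁ z≤n) _ c≢1 c≢0 _ e₁ e₀ = ⊥-elim (not-reversed _ c≢0 c≢1 e₁ e₀)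
  anchors-fixed (inj₁ a≤1) (inj₂ refl) _ _ _ e _ _ = ⊥-elim (no-edge-to-last a≤1 e)
  anchors-fixed (inj₂ refl) (inj₁ b≤1) _ _ _ e _ _ =
    ⊥-elim (no-edge-to-last b≤1 (trans (symmetric _ (3 + m)) e))
  anchors-fixed (inj₂ refl) (inj₂ refl) a≢b _ _ _ _ _ = ⊥-elim (a≢b refl)

spiralAdj : ℕ → ℕ → Bool
spiralAdj a b = inv (spiral a) (spiral b)

spiral-separating : Separating spiralAdj
spiral-separating zero    j ()
spiral-separating (suc l) j j<1+l = pin-separates (spiral-shape l) j j<1+l

spiral-first-edge : spiralAdj 0 1 ≡ true
spiral-first-edge = inv-sides {false} {true} {spiral 0} {spiral 1} (+<+ (s≤s (s≤s z≤n))) -<+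

spiral-south-isolated : ∀ t → spiralAdj 0 (3 + quad t) ≡ false
spiral-south-isolated t =
  trans (cong (inv (spiral 0)) (spiral-point south t)) (inv-sides {false} {false} {spiral 0} {point south t} -<+ (-<- (s≤s z≤n)))

lastIndex : ℕ → ℕ
lastIndex i = 3 + quad i

endLabel : ℕ → ℕ → Bool
endLabel L x = does (x ℕP.≤? 1) ∨ does (x ℕP.≟ L)

endLabel-anchor : ∀ L x → endLabel L x ≡ true → Anchor L x
endLabel-anchor L x = decode (x ℕP.≤? 1) (x ℕP.≟ L)
  where
  decode : (low? : Dec (x ≤ 1)) (last? : Dec (x ≡ L)) → does low? ∨ does last? ≡ true → Anchor L x
  decode (yes x≤1) _         _ = inj₁ x≤1
  decode (no _)    (yes x≡L) _ = inj₂ x≡L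
  decode (no _)    (no _)    ()

endLabel-last : ∀ L → endLabel L L ≡ true
endLabel-last L = trans (cong (does (L ℕP.≤? 1) ∨_) (dec-true (L ℕP.≟ L) refl)) (∨-zeroʳ _)

spiralFamily : ℕ → Labelled Bool
spiralFamily i = record
  { graph = pointGraph spiral (suc (lastIndex i))
  ; label = λ v → endLabel (lastIndex i) (toℕ v) }

quad-injective : ∀ {i j} → quad i ≡ quad j → i ≡ j
quad-injective {zero}  {zero}  _ = refl
quad-injective {suc i} {suc j} e = cong suc (quad-injective (ℕP.+-cancelˡ-≡ 4 _ _ e))

-- An embedding of member i into member j fixes the anchors 0 and 1 (labels and
-- `Anchoring`), hence every vertex (`Rigidity`); so the last vertex 4i+3 of
-- member i lands on a labelled vertex of member j, which forces i = j.
spiralFamily-antichain : ∀ i j → i ≢ j → ¬ (spiralFamily i ⊑₂ spiralFamily j)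
spiralFamily-antichain i j i≢j (f , f-injective , f-adj , f-label) =
  [ (λ { (s≤s ()) }) , (λ e → i≢j (quad-injective (ℕP.+-cancelˡ-≡ 3 _ _ e))) ]′
    (subst (Anchor (lastIndex j)) (trans (fixed lastVertex) (FinP.toℕ-fromℕ (lastIndex i)))
           (anchor lastVertex lastVertex-labelled))
  where
  open Anchoring {spiralAdj} spiral-separating (λ a b → inv-sym (spiral a) (spiral b)) (quad j)
                 spiral-first-edge (spiral-south-isolated j)

  anchor : ∀ v → endLabel (lastIndex i) (toℕ v) ≡ true → Anchor (lastIndex j) (toℕ (f v))
  anchor v labelled = endLabel-anchor (lastIndex j) (toℕ (f v)) (trans (sym (f-label v)) labelled)

  image-distinct : ∀ {u v} → u ≢ v → toℕ (f u) ≢ toℕ (f v)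
  image-distinct u≢v e = u≢v (f-injective (FinP.toℕ-injective e))

  ends : toℕ (f Fin.zero) ≡ 0 × toℕ (f (Fin.suc Fin.zero)) ≡ 1
  ends = anchors-fixed (anchor Fin.zero refl) (anchor (Fin.suc Fin.zero) refl)
    (image-distinct (λ ())) (image-distinct (λ ())) (image-distinct (λ ()))
    (f-adj _ _) (f-adj _ (Fin.suc (Fin.suc Fin.zero))) (f-adj _ _)

  anchored : ∀ v → toℕ v ≤ 1 → toℕ (f v) ≡ toℕ v
  anchored Fin.zero _ = proj₁ ends
  anchored (Fin.suc Fin.zero) _ = proj₂ ends
  anchored (Fin.suc (Fin.suc v)) (s≤s ())

  open Rigidity {spiralAdj} spiral-separating f f-injective f-adj anchored using (fixed)

  lastVertex : Fin (suc (lastIndex i))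
  lastVertex = Fin.fromℕ (lastIndex i)

  lastVertex-labelled : endLabel (lastIndex i) (toℕ lastVertex) ≡ true
  lastVertex-labelled = subst (λ x → endLabel (lastIndex i) x ≡ true)
    (sym (FinP.toℕ-fromℕ (lastIndex i))) (endLabel-last (lastIndex i))

proposition12 : Σ (ℕ → Labelled Bool) λ A →
    (∀ i → InGW (graph (A i))) ×
    (∀ i j → i ≢ j → ¬ (A i ⊑₂ A j))
proposition12 =
  spiralFamily ,
  (λ i → spiral-inGW (suc (lastIndex i)) (s≤s (s≤s (s≤s (s≤s z≤n))))) ,
  spiralFamily-antichain
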